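{- (1) If $G$ is a pseudograph with two nodes and $n$ edges between them (and no other edges or loops), then $\mathcal{K}G$ is isomorphic to $\mathcal{P}_n \times \Delta_1$. (2) If $G$ is a pseudograph with one node and $n$ loops, then $\mathcal{K}G$ is isomorphic to $\mathcal{P}_n \times \rho$, where $\rho$ is a ray.
   Context: A pseudograph is a finite graph in which loops and multiple edges are allowed. For a connected pseudograph $H$: a tube of $H$ is a proper connected subgraph $t$ of $H$ such that whenever two nodes of $t$ are joined by at least one edge of $H$, $t$ contains at least one edge joining them; two tubes are compatible if one properly contains the other, or if they are disjoint and cannot be connected by a single edge of $H$; a tubing is a set of pairwise compatible tubes (for connected $H$, $H$ itself is never a tube). The pseudograph associahedron $\mathcal{K}H$ is the simple polytope (or polytopal cone, if $H$ has loops) whose face poset is isomorphic to the poset of tubings of $H$ ordered by reverse inclusion. The permutohedron $\mathcal{P}_n$ is the $(n-1)$-dimensional polytope whose faces are in bijection with the strict weak orderings (ordered set partitions) of $n$ letters, its $n!$ vertices corresponding to the permutations. $\Delta_1$ is an interval. "Isomorphic" means having isomorphic face posets. -}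

module Defs where

open import Data.Nat using (ℕ; zero; suc)
open import Data.Fin using (Fin; zero; suc)
import Data.Fin as F
open import Data.Fin.Subset using (Subset; _∈_; _⊆_; ⊤)
open import Data.Product using (Σ; ∃; ∃-syntax; _×_; _,_; proj₁; proj₂)
open import Data.Sum using (_⊎_)
open import Data.Empty using (⊥)
open import Data.List using (List)
import Data.List.Membership.Propositional as LM
open import Relation.Nullary using (¬_)
open import Relation.Binary.PropositionalEquality using (_≡_; _≢_)
open import Function.Bundles using (_⇔_)

record Pseudograph : Set where
  field
    V    : ℕ
    E    : ℕ
    ends : Fin E → Fin V × Fin V
open Pseudograph public

Joins : (G : Pseudograph) → Fin (E G) → Fin (V G) → Fin (V G) → Set
Joins G e x y = (ends G e ≡ (x , y)) ⊎ (ends G e ≡ (y , x))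

SubG : Pseudograph → Set
SubG G = Subset (V G) × Subset (E G)

IsSubgraph : (G : Pseudograph) → SubG G → Set
IsSubgraph G (ns , es) =
  ∀ e → e ∈ es → (proj₁ (ends G e) ∈ ns) × (proj₂ (ends G e) ∈ ns)

data Reach (G : Pseudograph) (es : Subset (E G)) :
       Fin (V G) → Fin (V G) → Set where
  here : ∀ {x} → Reach G es x x
  step : ∀ {x y z} (e : Fin (E G)) → e ∈ es → Joins G e x y →
         Reach G es y z → Reach G es x z

IsConnected : (G : Pseudograph) → SubG G → Set
IsConnected G (ns , es) =
  (∃[ x ] x ∈ ns) × (∀ x y → x ∈ ns → y ∈ ns → Reach G es x y)

ConnectedGraph : Pseudograph → Set
ConnectedGraph G = IsConnected G (⊤ , ⊤)

_⊂ₛ_ : {G : Pseudograph} → SubG G → SubG G → Set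
(ns , es) ⊂ₛ (ns' , es') = ns ⊆ ns' × es ⊆ es' × ¬ ((ns , es) ≡ (ns' , es'))

IsTube : (G : Pseudograph) → SubG G → Set
IsTube G t@(ns , es) =
  IsSubgraph G t × IsConnected G t × ¬ (t ≡ (⊤ , ⊤)) ×
  (∀ x y → x ∈ ns → y ∈ ns → x ≢ y →
     (∃[ e ] Joins G e x y) → ∃[ e ] (e ∈ es × Joins G e x y))

Compatible : (G : Pseudograph) → SubG G → SubG G → Set
Compatible G t@(ns , es) t'@(ns' , es') =
  _⊂ₛ_ {G} t t' ⊎ _⊂ₛ_ {G} t' t ⊎
  ((∀ x → x ∈ ns → ¬ (x ∈ ns')) ×
   (∀ x y (e : Fin (E G)) → x ∈ ns → y ∈ ns' → ¬ Joins G e x y))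

-- tubings: finite sets (lists, up to having the same members) of
-- pairwise compatible tubes
record Tubing (G : Pseudograph) : Set where
  field
    tubes  : List (SubG G)
    areTubes : ∀ t → t LM.∈ tubes → IsTube G t
    pairwise : ∀ t t' → t LM.∈ tubes → t' LM.∈ tubes → t ≢ t' →
               Compatible G t t'
open Tubing public

-- Face posets.  A face poset is a carrier with its order; equality of
-- faces is mutual comparability (all orders below are partial orders
-- up to this equivalence).

record FacePoset : Set₁ where
  field
    Face : Set
    _≼_  : Face → Face → Set

open FacePoset public

record _≅_ (P Q : FacePoset) : Set where
  private
    module P = FacePoset P
    module Q = FacePoset Q
  field
    to      : P.Face → Q.Face
    order   : ∀ a b → (a P.≼ b) ⇔ (to a Q.≼ to b)
    onto    : ∀ q → ∃[ p ] ((to p Q.≼ q) × (q Q.≼ to p))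

_⊗_ : FacePoset → FacePoset → FacePoset
P ⊗ Q = record
  { Face = FacePoset.Face P × FacePoset.Face Q
  ; _≼_  = λ (a , b) (a' , b') → FacePoset._≼_ P a a' × FacePoset._≼_ Q b b' }

KFaces : Pseudograph → FacePoset
KFaces G = record
  { Face = Tubing G
  ; _≼_  = λ T T' → ∀ t → t LM.∈ tubes T' → t LM.∈ tubes T }

-- The permutohedron P_n: faces are ordered set partitions of n letters,
-- i.e. surjections blk : Fin n → Fin k onto k (ordered) blocks.
-- Face inclusion F ≤ G: F refines G as a weak ordering.

record OrdPartition (n : ℕ) : Set where
  field
    k    : ℕ
    blk  : Fin n → Fin k
    surj : ∀ b → ∃[ i ] blk i ≡ b
open OrdPartition public

Permutohedron : ℕ → FacePoset
Permutohedron n = record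
  { Face = OrdPartition n
  ; _≼_  = λ F G → ∀ i j → blk F i F.≤ blk F j → blk G i F.≤ blk G j }

data IntervalFace : Set where
  left right whole : IntervalFace

data _≤Δ_ : IntervalFace → IntervalFace → Set where
  refl≤  : ∀ {x} → x ≤Δ x
  ≤whole : ∀ {x} → x ≤Δ whole

Δ₁ : FacePoset
Δ₁ = record { Face = IntervalFace ; _≼_ = _≤Δ_ }

data RayFace : Set where
  apex ray : RayFace

data _≤ρ_ : RayFace → RayFace → Set where
  refl≤ : ∀ {x} → x ≤ρ x
  ≤ray  : ∀ {x} → x ≤ρ ray

ρ : FacePoset
ρ = record { Face = RayFace ; _≼_ = _≤ρ_ }

twoNodes : ℕ → Pseudograph
twoNodes n = record { V = 2 ; E = n ; ends = λ _ → (zero , suc zero) }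

oneNode : ℕ → Pseudograph
oneNode n = record { V = 1 ; E = n ; ends = λ _ → (zero , zero) }

-- In both graphs every tube containing an edge contains all nodes,
-- so two such tubes are never disjoint and compatibility forces them to be
-- nested.  The edge sets of the tubes with edges of a tubing thus form a
-- chain of nonempty proper sets of edges, i.e. an ordered set partition of
-- the edges: a face of P_n.  The other tubes are edgeless, hence single
-- nodes lying inside every tube with edges; they give the factor Δ₁ (two
-- adjacent nodes, at most one of them used) or ρ (the node, used or not).
module Submission where

open import Defs
open import Data.Nat as ℕ using (ℕ; zero; suc; _≤_; _<_; _⊔_; z≤n; s≤s)
open import Data.Nat.Properties
open import Data.Fin using (Fin; zero; suc; toℕ; fromℕ<)
open import Data.Fin.Properties using (any?; all?; ¬∀⟶∃¬; toℕ<n; toℕ-fromℕ<; toℕ-injective)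
open import Data.Fin.Subset using (Subset; _∈_; _∉_; _⊆_; ⊤; ⁅_⁆) renaming (⊥ to ∅)
open import Data.Fin.Subset.Properties using (_∈?_; ∈⊤; ∉⊥; ⊆-antisym; x∈⁅x⁆; x∈⁅y⁆⇒x≡y)
open import Data.Bool using (true)
import Data.Bool as Bool
import Data.Product.Properties as Product
open import Data.Vec using (tabulate)
open import Data.Vec.Properties as Vec using (lookup∘tabulate; lookup⇒[]=; []=⇒lookup)
open import Data.List using (List; []; _∷_; _++_; filter; applyUpTo)
open import Data.List.Membership.Propositional.Properties
  using (∈-filter⁺; ∈-filter⁻; ∈-applyUpTo⁺; ∈-applyUpTo⁻; ∈-++⁺ˡ; ∈-++⁺ʳ; ∈-++⁻)
open import Data.List.Membership.Propositional using () renaming (_∈_ to _∈ₗ_)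
open import Data.List.Relation.Unary.Any using (here; there)
open import Data.Product using (∃; ∃-syntax; _×_; _,_; proj₁; proj₂)
open import Data.Sum using (_⊎_; inj₁; inj₂)
open import Data.Empty using (⊥-elim)
open import Relation.Nullary using (¬_; ¬?; Dec; yes; no; does)
open import Relation.Nullary.Decidable using (decidable-stable; dec-true)
open import Relation.Unary using (Pred; Decidable)
open import Relation.Binary using (Rel; Reflexive; Transitive; Total; tri<; tri≈; tri>)
open import Relation.Binary.PropositionalEquality
open import Function using (_∘_; case_of_)
open import Function.Bundles using (_⇔_; mk⇔; Equivalence)

maxOf : ∀ {n} → (Fin n → ℕ) → ℕ
maxOf {zero}  f = 0
maxOf {suc n} f = f zero ⊔ maxOf (f ∘ suc)

maxOf-upper : ∀ {n} (f : Fin n → ℕ) i → f i ≤ maxOf f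
maxOf-upper f zero    = m≤m⊔n _ _
maxOf-upper f (suc i) = ≤-trans (maxOf-upper (f ∘ suc) i) (m≤n⊔m _ _)

-- Any ranking f of n letters by naturals determines an ordered set
-- partition: letters with equal rank share a block, and the blocks are
-- ordered by rank.  The block of i is the number of values of f below f i.
module Ranking {n : ℕ} (f : Fin n → ℕ) where

  Attained : ℕ → Set
  Attained v = ∃[ i ] f i ≡ v

  attained? : ∀ v → Dec (Attained v)
  attained? v = any? (λ i → f i ℕ.≟ v)

  rank : ℕ → ℕ
  rank zero = 0
  rank (suc v) with attained? v
  ... | yes _ = suc (rank v)
  ... | no _  = rank v

  rank-step : ∀ v → rank v ≤ rank (suc v)
  rank-step v with attained? v
  ... | yes _ = n≤1+n _
  ... | no _  = ≤-refl

  rank-attained : ∀ {v} → Attained v → rank (suc v) ≡ suc (rank v)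
  rank-attained {v} a with attained? v
  ... | yes _ = refl
  ... | no ¬a = ⊥-elim (¬a a)

  rank-mono : ∀ {v w} → v ≤ w → rank v ≤ rank w
  rank-mono {w = zero}  z≤n = ≤-refl
  rank-mono {w = suc w} v≤w with m≤n⇒m<n∨m≡n v≤w
  ... | inj₁ (s≤s v≤w′) = ≤-trans (rank-mono v≤w′) (rank-step w)
  ... | inj₂ refl       = ≤-refl

  rank-strict : ∀ {v w} → v < w → Attained v → rank v < rank w
  rank-strict v<w a = subst (_≤ _) (rank-attained a) (rank-mono v<w)

  rank-onto : ∀ v c → c < rank v → ∃[ w ] (rank w ≡ c × Attained w)
  rank-onto (suc v) c c< with attained? v
  ... | no _ = rank-onto v c c<
  ... | yes a with c ℕ.≟ rank v
  ...   | yes refl = v , refl , a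
  ...   | no c≢    = rank-onto v c (≤∧≢⇒< (≤-pred c<) c≢)

  blocks : ℕ
  blocks = rank (suc (maxOf f))

  rank-bound : ∀ i → rank (f i) < blocks
  rank-bound i = rank-strict (s≤s (maxOf-upper f i)) (i , refl)

  partition : OrdPartition n
  partition = record
    { k    = blocks
    ; blk  = λ i → fromℕ< (rank-bound i)
    ; surj = λ b → hit b (rank-onto _ (toℕ b) (toℕ<n b))
    }
    where
    hit : ∀ b → ∃[ w ] (rank w ≡ toℕ b × Attained w) → ∃[ i ] fromℕ< (rank-bound i) ≡ b
    hit b (w , rank≡ , i , refl) = i , toℕ-injective (trans (toℕ-fromℕ< (rank-bound i)) rank≡)

  partition-order : ∀ i j → (toℕ (blk partition i) ≤ toℕ (blk partition j)) ⇔ (f i ≤ f j)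
  partition-order i j = mk⇔ reflects preserves
    where
    block≡ : ∀ i → toℕ (blk partition i) ≡ rank (f i)
    block≡ i = toℕ-fromℕ< (rank-bound i)

    reflects : toℕ (blk partition i) ≤ toℕ (blk partition j) → f i ≤ f j
    reflects h = ≮⇒≥ λ fj<fi →
      <⇒≱ (rank-strict fj<fi (j , refl)) (subst₂ _≤_ (block≡ i) (block≡ j) h)

    preserves : f i ≤ f j → toℕ (blk partition i) ≤ toℕ (blk partition j)
    preserves h = subst₂ _≤_ (sym (block≡ i)) (sym (block≡ j)) (rank-mono h)

-- Reflexivity and transitivity of a face order, with the faces explicit
-- (they cannot be inferred, since face orders need not be injective).
Reflexive≼ : FacePoset → Set
Reflexive≼ P = ∀ a → _≼_ P a a

Transitive≼ : FacePoset → Set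
Transitive≼ P = ∀ a b c → _≼_ P a b → _≼_ P b c → _≼_ P a c

module _ where
  open _≅_

  ≅-trans : ∀ {P Q R} → Transitive≼ R → P ≅ Q → Q ≅ R → P ≅ R
  ≅-trans {P} {Q} {R} transR f g = record
    { to    = to g ∘ to f
    ; order = λ a b → mk⇔ (Equivalence.to (order g _ _) ∘ Equivalence.to (order f a b))
                          (Equivalence.from (order f a b) ∘ Equivalence.from (order g _ _))
    ; onto  = onto′
    }
    where
    onto′ : ∀ r → ∃[ p ] (_≼_ R (to g (to f p)) r × _≼_ R r (to g (to f p)))
    onto′ r with onto g r
    ... | q , gq≼r , r≼gq with onto f q
    ...   | p , fp≼q , q≼fp =
      p , transR _ _ _ (Equivalence.to (order g _ _) fp≼q) gq≼r
        , transR _ _ _ r≼gq (Equivalence.to (order g _ _) q≼fp)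

  ⊗-congʳ : ∀ {P Q Q′} → Reflexive≼ P → Q ≅ Q′ → (P ⊗ Q) ≅ (P ⊗ Q′)
  ⊗-congʳ reflP g = record
    { to    = λ (a , b) → a , to g b
    ; order = λ (a , b) (a′ , b′) →
        mk⇔ (λ (a≼ , b≼) → a≼ , Equivalence.to (order g b b′) b≼)
            (λ (a≼ , b≼) → a≼ , Equivalence.from (order g b b′) b≼)
    ; onto  = λ (a , q) → let (b , gb≼q , q≼gb) = onto g q in
                          (a , b) , (reflP a , gb≼q) , (reflP a , q≼gb)
    }

⊗-transitive : ∀ {P Q} → Transitive≼ P → Transitive≼ Q → Transitive≼ (P ⊗ Q)
⊗-transitive transP transQ (a , b) (a′ , b′) (a″ , b″) (a≼ , b≼) (a≼′ , b≼′) =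
  transP a a′ a″ a≼ a≼′ , transQ b b′ b″ b≼ b≼′

permutohedron-reflexive : ∀ n → Reflexive≼ (Permutohedron n)
permutohedron-reflexive n F i j h = h

permutohedron-transitive : ∀ n → Transitive≼ (Permutohedron n)
permutohedron-transitive n F F′ F″ F≼F′ F′≼F″ i j h = F′≼F″ i j (F≼F′ i j h)

Δ₁-transitive : Transitive≼ Δ₁
Δ₁-transitive x y .y x≤y refl≤  = x≤y
Δ₁-transitive x y _  _   ≤whole = ≤whole

ρ-transitive : Transitive≼ ρ
ρ-transitive x y .y x≤y refl≤ = x≤y
ρ-transitive x y _  _   ≤ray  = ≤ray

greatest : ∀ {n r p} (R : Rel (Fin n) r) → Reflexive R → Transitive R → Total R →
           {P : Pred (Fin n) p} → Decidable P → ∃ P → ∃[ m ] (P m × ∀ k → P k → R k m)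
greatest {zero} R reflR transR total P? (() , _)
greatest {suc n} R reflR transR total {P} P? ex with any? (P? ∘ suc)
... | no noneAbove = zero , atZero ex , bound
  where
  atZero : ∃ P → P zero
  atZero (zero  , p) = p
  atZero (suc i , p) = ⊥-elim (noneAbove (i , p))
  bound : ∀ k → P k → R k zero
  bound zero    _ = reflR
  bound (suc k) p = ⊥-elim (noneAbove (k , p))
... | yes exAbove
  with greatest (λ i j → R (suc i) (suc j)) reflR transR (λ i j → total (suc i) (suc j))
                (P? ∘ suc) exAbove
...   | m , pm , boundAbove with P? zero | total zero (suc m)
...     | yes p0 | inj₂ m≤0 = zero , p0 , bound
  where
  bound : ∀ k → P k → R k zero
  bound zero    _ = reflR
  bound (suc k) p = transR (boundAbove k p) m≤0
...     | yes p0 | inj₁ 0≤m = suc m , pm , bound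
  where
  bound : ∀ k → P k → R k (suc m)
  bound zero    _ = 0≤m
  bound (suc k) p = boundAbove k p
...     | no ¬p0 | _ = suc m , pm , bound
  where
  bound : ∀ k → P k → R k (suc m)
  bound zero    p = ⊥-elim (¬p0 p)
  bound (suc k) p = boundAbove k p

every-letter : ∀ {m} {S : Subset m} → (∀ x → x ∈ S) → S ≡ ⊤
every-letter all∈ = ⊆-antisym (λ _ → ∈⊤) (λ {x} _ → all∈ x)

missing-letter : ∀ {m} {S : Subset m} → S ≢ ⊤ → ∃[ e ] e ∉ S
missing-letter {m} {S} S≢⊤ = ¬∀⟶∃¬ m (_∈ S) (_∈? S) (S≢⊤ ∘ every-letter)

-- Lists of sets of letters, each item a of the list carrying the set
-- (set a); for a tubing, the items are tubes and the sets their edges.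
module Chains {A : Set} {m : ℕ} (set : A → Subset m) where

  Below : List A → Fin m → Fin m → Set
  Below L i j = ∀ a → a ∈ₗ L → j ∈ set a → i ∈ set a

  Chain : List A → Set
  Chain L = ∀ a b → a ∈ₗ L → b ∈ₗ L →
            ∀ i j → j ∈ set a → i ∉ set a → i ∈ set b → j ∈ set b

  misses : List A → Fin m → ℕ
  misses []      i = 0
  misses (a ∷ L) i with i ∈? set a
  ... | yes _ = misses L i
  ... | no _  = suc (misses L i)

  below-tail : ∀ {a L i j} → Below (a ∷ L) i j → Below L i j
  below-tail below b b∈L = below b (there b∈L)

  misses-≤ : ∀ L {i j} → Below L i j → misses L i ≤ misses L j
  misses-≤ []      below = z≤n
  misses-≤ (a ∷ L) {i} {j} below with i ∈? set a | j ∈? set a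
  ... | yes _   | yes _   = misses-≤ L (below-tail below)
  ... | yes _   | no _    = m≤n⇒m≤1+n (misses-≤ L (below-tail below))
  ... | no  i∉a | yes j∈a = ⊥-elim (i∉a (below a (here refl) j∈a))
  ... | no _    | no _    = s≤s (misses-≤ L (below-tail below))

  misses-< : ∀ L {i j a} → Below L i j → a ∈ₗ L → i ∈ set a → j ∉ set a →
             misses L i < misses L j
  misses-< (b ∷ L) {i} {j} below a∈L i∈a j∉a with i ∈? set b | j ∈? set b | a∈L
  ... | no  i∉b | yes j∈b | _          = ⊥-elim (i∉b (below b (here refl) j∈b))
  ... | no  i∉b | _       | here refl  = ⊥-elim (i∉b i∈a)
  ... | yes _   | yes j∈b | here refl  = ⊥-elim (j∉a j∈b)
  ... | yes _   | no _    | here refl  = s≤s (misses-≤ L (below-tail below))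
  ... | yes _   | yes _   | there a∈L′ = misses-< L (below-tail below) a∈L′ i∈a j∉a
  ... | yes _   | no _    | there a∈L′ = m<n⇒m<1+n (misses-< L (below-tail below) a∈L′ i∈a j∉a)
  ... | no _    | no _    | there a∈L′ = s≤s (misses-< L (below-tail below) a∈L′ i∈a j∉a)

  witness-tail : ∀ {a L} {P : A → Set} →
                 ∃[ b ] (b ∈ₗ L × P b) → ∃[ b ] (b ∈ₗ (a ∷ L) × P b)
  witness-tail (b , b∈L , p) = b , there b∈L , p

  misses-witness : ∀ L {i j} → misses L i < misses L j →
                   ∃[ a ] (a ∈ₗ L × i ∈ set a × j ∉ set a)
  misses-witness (a ∷ L) {i} {j} lt with i ∈? set a | j ∈? set a
  ... | yes i∈a | no j∉a = a , here refl , i∈a , j∉a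
  ... | yes _   | yes _  = witness-tail (misses-witness L lt)
  ... | no _    | yes _  = witness-tail (misses-witness L (≤-trans (n≤1+n _) lt))
  ... | no _    | no _   = witness-tail (misses-witness L (≤-pred lt))

  misses⇒below : ∀ L → Chain L → ∀ {i j} → misses L i ≤ misses L j → Below L i j
  misses⇒below L chain {i} {j} le a a∈L j∈a = decidable-stable (i ∈? set a) λ i∉a →
    <⇒≱ (misses-< L (λ b b∈L i∈b → chain a b a∈L b∈L i j j∈a i∉a i∈b) a∈L j∈a i∉a)
        le

  -- a nonempty proper set S which is a down-set for Below L, L a chain,
  -- is one of the sets of L: namely a set containing the letter t of S
  -- missed most often but not the letter b outside S missed least often
  down-set-member : ∀ L → Chain L → (S : Subset m) → (∃[ e ] e ∈ S) → (∃[ e ] e ∉ S) →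
                    (∀ i j → Below L i j → j ∈ S → i ∈ S) → ∃[ a ] (a ∈ₗ L × set a ≡ S)
  down-set-member L chain S inside outside down-closed
    with greatest (λ i j → misses L i ≤ misses L j) ≤-refl ≤-trans
                  (λ i j → ≤-total _ _) (_∈? S) inside
       | greatest (λ i j → misses L j ≤ misses L i) ≤-refl (λ p q → ≤-trans q p)
                  (λ i j → ≤-total _ _) (λ x → ¬? (x ∈? S)) outside
  ... | t , t∈S , t-greatest | b , b∉S , b-least
    with misses-witness L {t} {b}
           (≰⇒> λ b≤t → b∉S (down-closed b t (misses⇒below L chain b≤t) t∈S))
  ... | u , u∈L , t∈u , b∉u = u , u∈L , ⊆-antisym u⊆S S⊆u
    where
    u⊆S : set u ⊆ S
    u⊆S {x} x∈u = decidable-stable (x ∈? S) λ x∉S →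
      b∉u (misses⇒below L chain (b-least x x∉S) u u∈L x∈u)

    S⊆u : S ⊆ set u
    S⊆u {x} x∈S = misses⇒below L chain (t-greatest x x∈S) u u∈L t∈u

select : ∀ {m p} {P : Pred (Fin m) p} → Decidable P → Subset m
select P? = tabulate (λ e → does (P? e))

module _ {m p} {P : Pred (Fin m) p} (P? : Decidable P) where

  ∈-select : ∀ {e} → P e → e ∈ select P?
  ∈-select {e} pe = lookup⇒[]= e _ (trans (lookup∘tabulate _ e) (dec-true (P? e) pe))

  select-∈ : ∀ {e} → e ∈ select P? → P e
  select-∈ {e} e∈ = fromDoes (P? e) (trans (sym (lookup∘tabulate _ e)) ([]=⇒lookup e∈))
    where
    fromDoes : ∀ {q} {Q : Set q} (d : Dec Q) → does d ≡ true → Q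
    fromDoes (yes q) _ = q

module Levels {m : ℕ} (F : OrdPartition m) where

  block : Fin m → ℕ
  block e = toℕ (blk F e)

  level : ℕ → Subset m
  level c = select (λ e → block e ≤? c)

  ∈-level : ∀ {c e} → block e ≤ c → e ∈ level c
  ∈-level {c} = ∈-select (λ e → block e ≤? c)

  level-bound : ∀ {c e} → e ∈ level c → block e ≤ c
  level-bound {c} = select-∈ (λ e → block e ≤? c)

  letter-in : ∀ {c} → c < k F → ∃[ e ] block e ≡ c
  letter-in c<k with surj F (fromℕ< c<k)
  ... | e , blk≡ = e , trans (cong toℕ blk≡) (toℕ-fromℕ< c<k)

  level-nonempty : ∀ {c} → c < ℕ.pred (k F) → ∃[ e ] e ∈ level c
  level-nonempty {c} c<top with letter-in (<-≤-trans (s≤s z≤n) (pred-cancel-< {m = suc c} c<top))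
  ... | e , block≡0 = e , ∈-level (subst (_≤ _) (sym block≡0) z≤n)

  level-proper : ∀ {c} → c < ℕ.pred (k F) → ∃[ e ] e ∉ level c
  level-proper {c} c<top with letter-in (pred-cancel-< {m = suc c} c<top)
  ... | e , block≡ = e , λ e∈ → <-irrefl refl (subst (_≤ c) block≡ (level-bound e∈))

  level-mono : ∀ {c d} → c ≤ d → level c ⊆ level d
  level-mono c≤d e∈ = ∈-level (≤-trans (level-bound e∈) c≤d)

  level-strict : ∀ {c d} → c < d → d < ℕ.pred (k F) → level c ≢ level d
  level-strict {c} {d} c<d d<top eq with letter-in {d} (<-≤-trans d<top pred[n]≤n)
  ... | e , block≡ =
    <⇒≱ c<d (subst (_≤ c) block≡ (level-bound e∈level-c))
    where
    e∈level-c : e ∈ level c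
    e∈level-c = subst (e ∈_) (sym eq) (∈-level (≤-reflexive block≡))

_≟ₛ_ : ∀ {G} (s t : SubG G) → Dec (s ≡ t)
_≟ₛ_ = Product.≡-dec (Vec.≡-dec Bool._≟_) (Vec.≡-dec Bool._≟_)

Edgeless : (G : Pseudograph) → SubG G → Set
Edgeless G t = ∀ e → e ∉ proj₂ t

edgeless? : (G : Pseudograph) → Decidable (Edgeless G)
edgeless? G t = all? (λ e → ¬? (e ∈? proj₂ t))

some-edge : ∀ {G} t → ¬ Edgeless G t → ∃[ e ] e ∈ proj₂ t
some-edge {G} t has-edge with ¬∀⟶∃¬ (E G) _ (λ e → ¬? (e ∈? proj₂ t)) has-edge
... | e , ¬e∉t = e , decidable-stable (e ∈? proj₂ t) ¬e∉t

nodeTube : ∀ {G} → Fin (V G) → SubG G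
nodeTube x = ⁅ x ⁆ , ∅

nodeTube-edgeless : ∀ {G} x → Edgeless G (nodeTube {G} x)
nodeTube-edgeless x e = ∉⊥

node-tube : ∀ {G} x → nodeTube {G} x ≢ (⊤ , ⊤) → IsTube G (nodeTube {G} x)
node-tube {G} x proper =
  (λ e e∈ → ⊥-elim (∉⊥ e∈)) , ((x , x∈⁅x⁆ x) , walk) , proper ,
  λ y z y∈ z∈ y≢z _ → ⊥-elim (y≢z (same y∈ z∈))
  where
  same : ∀ {y z} → y ∈ ⁅ x ⁆ → z ∈ ⁅ x ⁆ → y ≡ z
  same y∈ z∈ = trans (x∈⁅y⁆⇒x≡y x y∈) (sym (x∈⁅y⁆⇒x≡y x z∈))

  walk : ∀ y z → y ∈ ⁅ x ⁆ → z ∈ ⁅ x ⁆ → Reach G ∅ y z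
  walk y z y∈ z∈ = subst (Reach G ∅ y) (same y∈ z∈) here

-- conversely, an edgeless tube is a single node: without edges a walk
-- cannot leave its starting node
edgeless-tube : ∀ {G} t → IsTube G t → Edgeless G t → ∃[ x ] t ≡ nodeTube {G} x
edgeless-tube {G} (ns , es) (_ , ((x , x∈ns) , connected) , _) edgeless-t =
  x , cong₂ _,_ (⊆-antisym ns⊆⁅x⁆ ⁅x⁆⊆ns)
                (⊆-antisym (λ e∈ → ⊥-elim (edgeless-t _ e∈)) (λ e∈ → ⊥-elim (∉⊥ e∈)))
  where
  stays : ∀ {y z} → Reach G es y z → y ≡ z
  stays here = refl
  stays (step e e∈ _ _) = ⊥-elim (edgeless-t e e∈)

  ns⊆⁅x⁆ : ns ⊆ ⁅ x ⁆
  ns⊆⁅x⁆ {y} y∈ = subst (_∈ ⁅ x ⁆) (stays (connected x y x∈ns y∈)) (x∈⁅x⁆ x)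

  ⁅x⁆⊆ns : ⁅ x ⁆ ⊆ ns
  ⁅x⁆⊆ns {y} y∈ = subst (_∈ ns) (sym (x∈⁅y⁆⇒x≡y x y∈)) x∈ns

record NodeTubing (G : Pseudograph) : Set where
  field
    tubing   : Tubing G
    edgeless : ∀ t → t ∈ₗ tubes tubing → Edgeless G t
open NodeTubing

NodeFaces : Pseudograph → FacePoset
NodeFaces G = record
  { Face = NodeTubing G
  ; _≼_  = λ N N′ → _≼_ (KFaces G) (tubing N) (tubing N′)
  }

SameTubes : ∀ {G} → NodeTubing G → NodeTubing G → Set
SameTubes {G} N N′ = _≼_ (NodeFaces G) N N′ × _≼_ (NodeFaces G) N′ N

-- The tubes with edges of a tubing are
-- then nested, so they amount to an ordered partition of the edges (edge
-- i precedes j when every tube containing j contains i), while the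
-- remaining tubes are edgeless and lie inside every tube with edges, so
-- both parts can be chosen independently.
module Split (G : Pseudograph)
  (all-nodes : ∀ t → IsTube G t → ∀ e → e ∈ proj₂ t → proj₁ t ≡ ⊤)
  (edge-tube : ∀ S → (∃[ e ] e ∈ S) → (∃[ e ] e ∉ S) → IsTube G (⊤ , S))
  where

  open Chains (proj₂ {A = Subset (V G)} {B = λ _ → Subset (E G)})

  -- two tubes with edges share all nodes, so compatibility forces them
  -- to be nested
  tubes-chain : (T : Tubing G) → Chain (tubes T)
  tubes-chain T a b a∈T b∈T i j j∈a i∉a i∈b with _≟ₛ_ {G} a b
  ... | yes refl = j∈a
  ... | no a≢b with pairwise T a b a∈T b∈T a≢b
  ...   | inj₁ (_ , a⊆b , _)         = a⊆b j∈a
  ...   | inj₂ (inj₁ (_ , b⊆a , _))  = ⊥-elim (i∉a (b⊆a i∈b))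
  ...   | inj₂ (inj₂ (disjoint , _)) = ⊥-elim (disjoint x x∈a x∈b)
    where
    x : Fin (V G)
    x = proj₁ (ends G j)
    x∈a : x ∈ proj₁ a
    x∈a = proj₁ (proj₁ (areTubes T a a∈T) j j∈a)
    x∈b : x ∈ proj₁ b
    x∈b = subst (x ∈_) (sym (all-nodes b (areTubes T b b∈T) i i∈b)) ∈⊤

  edgeOrder : Tubing G → OrdPartition (E G)
  edgeOrder T = Ranking.partition (misses (tubes T))

  edgeOrder-below : ∀ T i j →
    (toℕ (blk (edgeOrder T) i) ≤ toℕ (blk (edgeOrder T) j)) ⇔ Below (tubes T) i j
  edgeOrder-below T i j = mk⇔
    (misses⇒below (tubes T) (tubes-chain T) ∘ Equivalence.to (Ranking.partition-order _ i j))
    (Equivalence.from (Ranking.partition-order _ i j) ∘ misses-≤ (tubes T))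

  -- a tube with edges is recovered from the edge order: if T′ orders the
  -- edges more coarsely than T, each tube of T′ with an edge lies in T
  edge-tube-reflected : (T T′ : Tubing G) →
    (∀ i j → Below (tubes T) i j → Below (tubes T′) i j) →
    ∀ t → t ∈ₗ tubes T′ → ∃[ e ] e ∈ proj₂ t → t ∈ₗ tubes T
  edge-tube-reflected T T′ coarser (ns , S) t∈T′ (e , e∈S) =
    located (down-set-member (tubes T) (tubes-chain T) S (e , e∈S) (missing-letter S≢⊤) closed)
    where
    ns≡⊤ : ns ≡ ⊤
    ns≡⊤ = all-nodes _ (areTubes T′ _ t∈T′) e e∈S

    S≢⊤ : S ≢ ⊤
    S≢⊤ S≡⊤ = proj₁ (proj₂ (proj₂ (areTubes T′ _ t∈T′))) (cong₂ _,_ ns≡⊤ S≡⊤)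

    closed : ∀ i j → Below (tubes T) i j → j ∈ S → i ∈ S
    closed i j below = coarser i j below (ns , S) t∈T′

    located : ∃[ u ] (u ∈ₗ tubes T × proj₂ u ≡ S) → (ns , S) ∈ₗ tubes T
    located ((ns′ , _) , u∈T , refl) =
      subst (λ ns″ → (ns″ , S) ∈ₗ tubes T)
            (trans (all-nodes _ (areTubes T _ u∈T) e e∈S) (sym ns≡⊤)) u∈T

  levelTubes : OrdPartition (E G) → List (SubG G)
  levelTubes F = applyUpTo (λ c → ⊤ , Levels.level F c) (ℕ.pred (k F))

  module _ (F : OrdPartition (E G)) where
    open Levels F

    levelTube-index : ∀ {t} → t ∈ₗ levelTubes F →
                      ∃[ c ] (c < ℕ.pred (k F) × t ≡ (⊤ , level c))
    levelTube-index = ∈-applyUpTo⁻ _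

    levelTube-isTube : ∀ t → t ∈ₗ levelTubes F → IsTube G t
    levelTube-isTube t t∈ with levelTube-index t∈
    ... | c , c<top , refl = edge-tube (level c) (level-nonempty c<top) (level-proper c<top)

    levelTube-not-edgeless : ∀ t → t ∈ₗ levelTubes F → ¬ Edgeless G t
    levelTube-not-edgeless t t∈ edgeless-t with levelTube-index t∈
    ... | c , c<top , refl = edgeless-t _ (proj₂ (level-nonempty c<top))

    levelTube-⊂ : ∀ {c d} → c < d → d < ℕ.pred (k F) → _⊂ₛ_ {G} (⊤ , level c) (⊤ , level d)
    levelTube-⊂ c<d d<top = (λ x∈ → x∈) , level-mono (<⇒≤ c<d) ,
                            λ eq → level-strict c<d d<top (cong proj₂ eq)

    levelTubes-compatible : ∀ t t′ → t ∈ₗ levelTubes F → t′ ∈ₗ levelTubes F → t ≢ t′ →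
                            Compatible G t t′
    levelTubes-compatible t t′ t∈ t′∈ t≢t′ with levelTube-index t∈ | levelTube-index t′∈
    ... | c , c<top , refl | d , d<top , refl with <-cmp c d
    ...   | tri< c<d _ _  = inj₁ (levelTube-⊂ c<d d<top)
    ...   | tri≈ _ refl _ = ⊥-elim (t≢t′ refl)
    ...   | tri> _ _ d<c  = inj₂ (inj₁ (levelTube-⊂ d<c c<top))

    edgeless-inside : ∀ t t′ → Edgeless G t → t′ ∈ₗ levelTubes F → _⊂ₛ_ {G} t t′
    edgeless-inside t t′ edgeless-t t′∈ with levelTube-index t′∈
    ... | c , c<top , refl =
      (λ _ → ∈⊤) , (λ e∈ → ⊥-elim (edgeless-t _ e∈)) ,
      λ eq → edgeless-t _ (subst (proj₁ (level-nonempty c<top) ∈_) (sym (cong proj₂ eq))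
                                 (proj₂ (level-nonempty c<top)))

    levelTubes-below : ∀ X → (∀ t → t ∈ₗ X → Edgeless G t) → ∀ i j →
                       Below (X ++ levelTubes F) i j ⇔ (block i ≤ block j)
    levelTubes-below X X-edgeless i j = mk⇔ to-blocks from-blocks
      where
      to-blocks : Below (X ++ levelTubes F) i j → block i ≤ block j
      to-blocks below with block j <? ℕ.pred (k F)
      ... | yes j<top =
        level-bound (below _ (∈-++⁺ʳ X (∈-applyUpTo⁺ _ j<top)) (∈-level ≤-refl))
      ... | no j≮top = ≤-trans (<⇒≤pred (toℕ<n (blk F i))) (≮⇒≥ j≮top)

      from-blocks : block i ≤ block j → Below (X ++ levelTubes F) i j
      from-blocks le t t∈ j∈t with ∈-++⁻ X t∈
      ... | inj₁ t∈X = ⊥-elim (X-edgeless t t∈X j j∈t)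
      ... | inj₂ t∈L with levelTube-index t∈L
      ...   | c , _ , refl = ∈-level (≤-trans le (level-bound j∈t))

  assemble : OrdPartition (E G) → NodeTubing G → Tubing G
  assemble F N = record
    { tubes    = tubes (tubing N) ++ levelTubes F
    ; areTubes = is-tube
    ; pairwise = compatible
    }
    where
    X : List (SubG G)
    X = tubes (tubing N)

    is-tube : ∀ t → t ∈ₗ X ++ levelTubes F → IsTube G t
    is-tube t t∈ with ∈-++⁻ X t∈
    ... | inj₁ t∈X = areTubes (tubing N) t t∈X
    ... | inj₂ t∈L = levelTube-isTube F t t∈L

    compatible : ∀ t t′ → t ∈ₗ X ++ levelTubes F → t′ ∈ₗ X ++ levelTubes F → t ≢ t′ →
                 Compatible G t t′
    compatible t t′ t∈ t′∈ t≢t′ with ∈-++⁻ X t∈ | ∈-++⁻ X t′∈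
    ... | inj₁ t∈X | inj₁ t′∈X = pairwise (tubing N) t t′ t∈X t′∈X t≢t′
    ... | inj₁ t∈X | inj₂ t′∈L = inj₁ (edgeless-inside F t t′ (edgeless N t t∈X) t′∈L)
    ... | inj₂ t∈L | inj₁ t′∈X =
      inj₂ (inj₁ (edgeless-inside F t′ t (edgeless N t′ t′∈X) t∈L))
    ... | inj₂ t∈L | inj₂ t′∈L = levelTubes-compatible F t t′ t∈L t′∈L t≢t′

  nodePart : Tubing G → NodeTubing G
  nodePart T = record
    { tubing   = record
      { tubes    = filter (edgeless? G) (tubes T)
      ; areTubes = λ t t∈ → areTubes T t (from-T t∈)
      ; pairwise = λ t t′ t∈ t′∈ → pairwise T t t′ (from-T t∈) (from-T t′∈)
      }
    ; edgeless = λ t t∈ → proj₂ (∈-filter⁻ (edgeless? G) {xs = tubes T} t∈)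
    }
    where
    from-T : ∀ {t} → t ∈ₗ filter (edgeless? G) (tubes T) → t ∈ₗ tubes T
    from-T t∈ = proj₁ (∈-filter⁻ (edgeless? G) {xs = tubes T} t∈)

  nodePart-assemble : ∀ F N → SameTubes (nodePart (assemble F N)) N
  nodePart-assemble F N = sub , sup
    where
    sub : ∀ t → t ∈ₗ tubes (tubing N) → t ∈ₗ tubes (tubing (nodePart (assemble F N)))
    sub t t∈N = ∈-filter⁺ (edgeless? G) (∈-++⁺ˡ t∈N) (edgeless N t t∈N)

    sup : ∀ t → t ∈ₗ tubes (tubing (nodePart (assemble F N))) → t ∈ₗ tubes (tubing N)
    sup t t∈ with ∈-filter⁻ (edgeless? G) {xs = tubes (assemble F N)} t∈
    ... | t∈A , edgeless-t with ∈-++⁻ (tubes (tubing N)) t∈A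
    ...   | inj₁ t∈N = t∈N
    ...   | inj₂ t∈L = ⊥-elim (levelTube-not-edgeless F t t∈L edgeless-t)

  Factors : FacePoset
  Factors = Permutohedron (E G) ⊗ NodeFaces G

  decompose : Tubing G → Face Factors
  decompose T = edgeOrder T , nodePart T

  edgeOrder-≼ : ∀ T T′ → _≼_ (Permutohedron (E G)) (edgeOrder T) (edgeOrder T′) ⇔
                         (∀ i j → Below (tubes T) i j → Below (tubes T′) i j)
  edgeOrder-≼ T T′ = mk⇔
    (λ ≼′ i j → Equivalence.to (edgeOrder-below T′ i j) ∘ ≼′ i j ∘
                Equivalence.from (edgeOrder-below T i j))
    (λ ⇒′ i j → Equivalence.from (edgeOrder-below T′ i j) ∘ ⇒′ i j ∘
                Equivalence.to (edgeOrder-below T i j))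

  decompose-monotone : ∀ T T′ → _≼_ (KFaces G) T T′ →
                       _≼_ Factors (decompose T) (decompose T′)
  decompose-monotone T T′ T′⊆T =
    Equivalence.from (edgeOrder-≼ T T′) (λ i j below t t∈T′ → below t (T′⊆T t t∈T′)) ,
    λ t t∈ → let (t∈T′ , edgeless-t) = ∈-filter⁻ (edgeless? G) {xs = tubes T′} t∈ in
             ∈-filter⁺ (edgeless? G) (T′⊆T t t∈T′) edgeless-t

  -- conversely, the two parts determine the tubes: edgeless tubes are
  -- kept in the edgeless part, tubes with edges are recovered from the
  -- edge order
  decompose-reflects : ∀ T T′ → _≼_ Factors (decompose T) (decompose T′) →
                       _≼_ (KFaces G) T T′
  decompose-reflects T T′ (edges≼ , nodes≼) t t∈T′ with edgeless? G t
  ... | yes edgeless-t =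
    proj₁ (∈-filter⁻ (edgeless? G) {xs = tubes T}
            (nodes≼ t (∈-filter⁺ (edgeless? G) t∈T′ edgeless-t)))
  ... | no has-edge =
    edge-tube-reflected T T′ (Equivalence.to (edgeOrder-≼ T T′) edges≼)
                        t t∈T′ (some-edge {G} t has-edge)

  decompose-onto : ∀ q → ∃[ T ] (_≼_ Factors (decompose T) q × _≼_ Factors q (decompose T))
  decompose-onto (F , N) =
    A , ((λ i j → to-F i j ∘ Equivalence.to (edgeOrder-below A i j)) ,
         proj₁ (nodePart-assemble F N))
      , ((λ i j → Equivalence.from (edgeOrder-below A i j) ∘ from-F i j) ,
         proj₂ (nodePart-assemble F N))
    where
    A : Tubing G
    A = assemble F N

    to-F : ∀ i j → Below (tubes A) i j → toℕ (blk F i) ≤ toℕ (blk F j)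
    to-F i j = Equivalence.to (levelTubes-below F (tubes (tubing N)) (edgeless N) i j)

    from-F : ∀ i j → toℕ (blk F i) ≤ toℕ (blk F j) → Below (tubes A) i j
    from-F i j = Equivalence.from (levelTubes-below F (tubes (tubing N)) (edgeless N) i j)

  split : KFaces G ≅ Factors
  split = record
    { to    = decompose
    ; order = λ T T′ → mk⇔ (decompose-monotone T T′) (decompose-reflects T T′)
    ; onto  = decompose-onto
    }

  split-via : ∀ {Q} → Transitive≼ Q → NodeFaces G ≅ Q →
              KFaces G ≅ (Permutohedron (E G) ⊗ Q)
  split-via {Q} transQ nodes =
    ≅-trans {R = Permutohedron (E G) ⊗ Q}
            (⊗-transitive {Permutohedron (E G)} {Q} (permutohedron-transitive (E G)) transQ)
            split (⊗-congʳ {Permutohedron (E G)} (permutohedron-reflexive (E G)) nodes)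

noTubes : ∀ {G} → NodeTubing G
noTubes = record
  { tubing   = record { tubes = [] ; areTubes = λ _ () ; pairwise = λ _ _ () }
  ; edgeless = λ _ ()
  }

oneTube : ∀ {G} t → IsTube G t → Edgeless G t → NodeTubing G
oneTube {G} t tube edgeless-t = record
  { tubing   = record
    { tubes    = t ∷ []
    ; areTubes = λ { _ (here refl) → tube }
    ; pairwise = λ { _ _ (here refl) (here refl) t≢t → ⊥-elim (t≢t refl) }
    }
  ; edgeless = λ { _ (here refl) → edgeless-t }
  }

classified : ∀ {G} (Q : FacePoset) (canon : Face Q → NodeTubing G)
             (face : NodeTubing G → Face Q) →
  (∀ x y → _≼_ Q x y ⇔ _≼_ (NodeFaces G) (canon x) (canon y)) →
  (∀ x → face (canon x) ≡ x) →
  (∀ N → SameTubes N (canon (face N))) →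
  NodeFaces G ≅ Q
classified Q canon face canon-order face-canon same-tubes = record
  { to    = face
  ; order = λ N N′ → mk⇔
      (λ N′⊆N → Equivalence.from (canon-order _ _) λ t t∈ →
         proj₂ (same-tubes N) t (N′⊆N t (proj₁ (same-tubes N′) t t∈)))
      (λ face≼ t t∈ → proj₁ (same-tubes N) t
         (Equivalence.to (canon-order _ _) face≼ t (proj₂ (same-tubes N′) t t∈)))
  ; onto  = λ x → canon x
                , subst (λ y → _≼_ Q y x) (sym (face-canon x)) (reflexive x)
                , subst (_≼_ Q x) (sym (face-canon x)) (reflexive x)
  }
  where
  reflexive : ∀ x → _≼_ Q x x
  reflexive x = Equivalence.from (canon-order x x) (λ _ t∈ → t∈)

module TwoNodes (n : ℕ) where

  G : Pseudograph
  G = twoNodes n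

  open import Data.List.Membership.DecPropositional (_≟ₛ_ {G}) using () renaming (_∈?_ to _∈ₗ?_)

  -- every edge joins the two nodes, so a tube with an edge has both
  all-nodes : ∀ t → IsTube G t → ∀ e → e ∈ proj₂ t → proj₁ t ≡ ⊤
  all-nodes t tube e e∈ = every-letter both
    where
    both : ∀ x → x ∈ proj₁ t
    both zero       = proj₁ (proj₁ tube e e∈)
    both (suc zero) = proj₂ (proj₁ tube e e∈)

  joins : ∀ e (x y : Fin 2) → x ≢ y → Joins G e x y
  joins e zero       zero       x≢y = ⊥-elim (x≢y refl)
  joins e zero       (suc zero) _   = inj₁ refl
  joins e (suc zero) zero       _   = inj₂ refl
  joins e (suc zero) (suc zero) x≢y = ⊥-elim (x≢y refl)

  walk : ∀ {es} e → e ∈ es → ∀ x y → Reach G es x y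
  walk e e∈ x y with x Data.Fin.≟ y
  ... | yes refl = here
  ... | no x≢y   = step e e∈ (joins e x y x≢y) here

  edge-tube : ∀ S → (∃[ e ] e ∈ S) → (∃[ e ] e ∉ S) → IsTube G (⊤ , S)
  edge-tube S (e , e∈S) (o , o∉S) =
    (λ _ _ → ∈⊤ , ∈⊤) , ((zero , ∈⊤) , λ x y _ _ → walk e e∈S x y) ,
    (λ eq → o∉S (subst (o ∈_) (sym (cong proj₂ eq)) ∈⊤)) ,
    (λ x y _ _ x≢y _ → e , e∈S , joins e x y x≢y)

  A B : SubG G
  A = nodeTube {G} zero
  B = nodeTube {G} (suc zero)

  A≢B : A ≢ B
  A≢B eq = case x∈⁅y⁆⇒x≡y (suc zero) (subst (zero ∈_) (cong proj₁ eq) (x∈⁅x⁆ zero)) of λ ()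

  edgeless-A-or-B : ∀ t → IsTube G t → Edgeless G t → t ≡ A ⊎ t ≡ B
  edgeless-A-or-B t tube edgeless-t with edgeless-tube t tube edgeless-t
  ... | zero     , t≡A = inj₁ t≡A
  ... | suc zero , t≡B = inj₂ t≡B

  -- given an edge, the two single nodes are adjacent, hence incompatible
  A-B-incompatible : Fin n → ¬ Compatible G A B
  A-B-incompatible e (inj₁ (A⊆B , _)) =
    case x∈⁅y⁆⇒x≡y (suc zero) (A⊆B (x∈⁅x⁆ zero)) of λ ()
  A-B-incompatible e (inj₂ (inj₁ (B⊆A , _))) =
    case x∈⁅y⁆⇒x≡y zero (B⊆A (x∈⁅x⁆ (suc zero))) of λ ()
  A-B-incompatible e (inj₂ (inj₂ (_ , no-edge))) =
    no-edge zero (suc zero) e (x∈⁅x⁆ zero) (x∈⁅x⁆ (suc zero)) (inj₁ refl)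

  A-tube : IsTube G A
  A-tube = node-tube zero (λ eq → case cong proj₁ eq of λ ())

  B-tube : IsTube G B
  B-tube = node-tube (suc zero) (λ eq → case cong proj₁ eq of λ ())

  canon : IntervalFace → NodeTubing G
  canon left  = oneTube A A-tube (nodeTube-edgeless {G} zero)
  canon right = oneTube B B-tube (nodeTube-edgeless {G} (suc zero))
  canon whole = noTubes

  face : NodeTubing G → IntervalFace
  face N with A ∈ₗ? tubes (tubing N) | B ∈ₗ? tubes (tubing N)
  ... | yes _ | _     = left
  ... | no _  | yes _ = right
  ... | no _  | no _  = whole

  canon-order : ∀ x y → x ≤Δ y ⇔ _≼_ (NodeFaces G) (canon x) (canon y)
  canon-order x y = mk⇔ (included x y) (compare x y)
    where
    included : ∀ x y → x ≤Δ y → _≼_ (NodeFaces G) (canon x) (canon y)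
    included x .x refl≤ t t∈ = t∈
    included x whole ≤whole t ()

    compare : ∀ x y → _≼_ (NodeFaces G) (canon x) (canon y) → x ≤Δ y
    compare left  left  _ = refl≤
    compare right right _ = refl≤
    compare x     whole _ = ≤whole
    compare left  right B⊆A with B⊆A B (here refl)
    ... | here B≡A = ⊥-elim (A≢B (sym B≡A))
    compare right left  A⊆B with A⊆B A (here refl)
    ... | here A≡B = ⊥-elim (A≢B A≡B)
    compare whole left  A⊆∅ with A⊆∅ A (here refl)
    ... | ()
    compare whole right B⊆∅ with B⊆∅ B (here refl)
    ... | ()

  face-canon : ∀ x → face (canon x) ≡ x
  face-canon left with A ∈ₗ? (A ∷ []) | B ∈ₗ? (A ∷ [])
  ... | yes _ | _     = refl
  ... | no A∉ | _     = ⊥-elim (A∉ (here refl))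
  face-canon right with A ∈ₗ? (B ∷ []) | B ∈ₗ? (B ∷ [])
  ... | yes (here A≡B) | _ = ⊥-elim (A≢B A≡B)
  ... | no _ | yes _    = refl
  ... | no _ | no B∉    = ⊥-elim (B∉ (here refl))
  face-canon whole = refl

  -- an edgeless tubing holds at most one of the two incompatible single
  -- nodes, so it is the canonical tubing of its face
  same-tubes : Fin n → ∀ N → SameTubes N (canon (face N))
  same-tubes e N = canon⊆N , N⊆canon
    where
    X : List (SubG G)
    X = tubes (tubing N)

    canon⊆N : ∀ t → t ∈ₗ tubes (tubing (canon (face N))) → t ∈ₗ X
    canon⊆N t t∈ with A ∈ₗ? X | B ∈ₗ? X | t∈
    ... | yes A∈ | _      | here refl = A∈
    ... | no _   | yes B∈ | here refl = B∈

    N⊆canon : ∀ t → t ∈ₗ X → t ∈ₗ tubes (tubing (canon (face N)))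
    N⊆canon t t∈ with A ∈ₗ? X | B ∈ₗ? X
                    | edgeless-A-or-B t (areTubes (tubing N) t t∈) (edgeless N t t∈)
    ... | yes _  | _     | inj₁ refl = here refl
    ... | yes A∈ | _     | inj₂ refl =
      ⊥-elim (A-B-incompatible e (pairwise (tubing N) A B A∈ t∈ A≢B))
    ... | no A∉  | _     | inj₁ refl = ⊥-elim (A∉ t∈)
    ... | no _   | yes _ | inj₂ refl = here refl
    ... | no _   | no B∉ | inj₂ refl = ⊥-elim (B∉ t∈)

  node-iso : Fin n → NodeFaces G ≅ Δ₁
  node-iso e = classified Δ₁ canon face canon-order face-canon (same-tubes e)

module OneNode (n : ℕ) where

  G : Pseudograph
  G = oneNode n

  open import Data.List.Membership.DecPropositional (_≟ₛ_ {G}) using () renaming (_∈?_ to _∈ₗ?_)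

  -- the node is the endpoint of every loop, so a tube with a loop has it
  all-nodes : ∀ t → IsTube G t → ∀ e → e ∈ proj₂ t → proj₁ t ≡ ⊤
  all-nodes t tube e e∈ = every-letter λ { zero → proj₁ (proj₁ tube e e∈) }

  edge-tube : ∀ S → (∃[ e ] e ∈ S) → (∃[ e ] e ∉ S) → IsTube G (⊤ , S)
  edge-tube S _ (o , o∉S) =
    (λ _ _ → ∈⊤ , ∈⊤) , ((zero , ∈⊤) , λ { zero zero _ _ → here }) ,
    (λ eq → o∉S (subst (o ∈_) (sym (cong proj₂ eq)) ∈⊤)) ,
    (λ { zero zero _ _ x≢y _ → ⊥-elim (x≢y refl) })

  P : SubG G
  P = nodeTube {G} zero

  module _ (e : Fin n) where

    -- given a loop, the bare node is not the whole graph
    P-tube : IsTube G P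
    P-tube = node-tube zero (λ eq → ∉⊥ (subst (e ∈_) (sym (cong proj₂ eq)) ∈⊤))

    canon : RayFace → NodeTubing G
    canon apex = oneTube P P-tube (nodeTube-edgeless {G} zero)
    canon ray  = noTubes

    face : NodeTubing G → RayFace
    face N with P ∈ₗ? tubes (tubing N)
    ... | yes _ = apex
    ... | no _  = ray

    canon-order : ∀ x y → x ≤ρ y ⇔ _≼_ (NodeFaces G) (canon x) (canon y)
    canon-order x y = mk⇔ (included x y) (compare x y)
      where
      included : ∀ x y → x ≤ρ y → _≼_ (NodeFaces G) (canon x) (canon y)
      included x .x refl≤ t t∈ = t∈
      included x ray  ≤ray t ()

      compare : ∀ x y → _≼_ (NodeFaces G) (canon x) (canon y) → x ≤ρ y
      compare apex apex _ = refl≤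
      compare x    ray  _ = ≤ray
      compare ray  apex P⊆∅ with P⊆∅ P (here refl)
      ... | ()

    face-canon : ∀ x → face (canon x) ≡ x
    face-canon apex with P ∈ₗ? (P ∷ [])
    ... | yes _ = refl
    ... | no P∉ = ⊥-elim (P∉ (here refl))
    face-canon ray = refl

    -- the only edgeless tube is the bare node
    same-tubes : ∀ N → SameTubes N (canon (face N))
    same-tubes N = canon⊆N , N⊆canon
      where
      X : List (SubG G)
      X = tubes (tubing N)

      canon⊆N : ∀ t → t ∈ₗ tubes (tubing (canon (face N))) → t ∈ₗ X
      canon⊆N t t∈ with P ∈ₗ? X | t∈
      ... | yes P∈ | here refl = P∈

      N⊆canon : ∀ t → t ∈ₗ X → t ∈ₗ tubes (tubing (canon (face N)))
      N⊆canon t t∈ with P ∈ₗ? X | edgeless-tube t (areTubes (tubing N) t t∈) (edgeless N t t∈)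
      ... | yes _ | zero , refl = here refl
      ... | no P∉ | zero , refl = ⊥-elim (P∉ t∈)

    node-iso : NodeFaces G ≅ ρ
    node-iso = classified ρ canon face canon-order face-canon same-tubes

-- Both graphs satisfy the hypotheses of Split, and their edgeless
-- tubings are classified by Δ₁ and ρ; the assumption n ≥ 1 provides the
-- edge needed for that classification.
proposition3 : (n : ℕ) → 1 ≤ n →
    (KFaces (twoNodes n) ≅ (Permutohedron n ⊗ Δ₁)) ×
    (KFaces (oneNode n) ≅ (Permutohedron n ⊗ ρ))
proposition3 n 1≤n =
    Split.split-via (twoNodes n) (TwoNodes.all-nodes n) (TwoNodes.edge-tube n)
      Δ₁-transitive (TwoNodes.node-iso n edge)
  , Split.split-via (oneNode n) (OneNode.all-nodes n) (OneNode.edge-tube n)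
      ρ-transitive (OneNode.node-iso n edge)
  where
  edge : Fin n
  edge = fromℕ< 1≤n
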